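{- Let $(H,\mathcal G)$ be a graph-decomposition of a finite connected graph $G$ whose adhesion graphs are pairwise disjoint. Then $\ell(H,\mathcal G)\ge g(H)\cdot d(H,\mathcal G)$.
   Context: Let $H$ be a multigraph and $\mathcal G=(G_h:h\in V(H))$ a family of subgraphs of $G$. $(H,\mathcal G)$ is a graph-decomposition of $G$ if $G=\bigcup_hG_h$ and for every $v\in V(G)$ the subgraph of $H$ induced on $\{h:v\in V(G_h)\}$ is connected. For an edge $e=h_0h_1$ of $H$ its adhesion graph is $G_e=G_{h_0}\cap G_{h_1}$. Assume adhesion graphs are pairwise disjoint. For $e=hh'$ let $X^e=V(G_e)$, $E^e_h=\partial_{G_h}X^e$ and $E^e_{h'}=\partial_{G_{h'}}X^e$ (edges of the respective part with exactly one end in $X^e$). A traversal of $s^e$ is a walk in $G$ whose first edge lies in one of $E^e_h,E^e_{h'}$, whose last edge lies in the other, and all of whose internal vertices lie in $X^e$. A closed walk $W$ traverses $s^e$ if some cyclic shift of $W$ contains a traversal of $s^e$ as a subwalk, and traverses it $k$ times if exactly $k$ cyclic shifts of $W$ have a traversal of $s^e$ as an initial segment. $H^W$ is the subgraph of $H$ formed by the edges $e$ such that $W$ traverses $s^e$ together with their endvertices. $\ell(H,\mathcal G)$ is the minimum length of a closed walk $W$ in $G$ that traverses every $s^e$ at most once and such that $H^W$ contains a cycle ($\infty$ if none exists). $d(H,\mathcal G)$ is the minimum of $d_{G_h}(G_e,G_f)$ over all nodes $h$ and all distinct edges $e,f$ of $H$ incident with $h$ ($\infty$ in edge cases, e.g.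 if there are no such pairs). $g(H)$ is the girth of $H$ ($\infty$ if $H$ is acyclic). -}

module Defs where

open import Data.Nat using (ℕ; zero; suc; _+_; _*_; _≤_; _<_)
open import Data.Fin using (Fin)
open import Data.Product using (Σ; ∃; _×_; _,_; proj₁; proj₂)
open import Data.Sum using (_⊎_)
open import Data.Unit using (⊤)
open import Data.Empty using (⊥)
open import Relation.Nullary using (¬_)
open import Relation.Binary.PropositionalEquality using (_≡_; _≢_)

data ℕ∞ : Set where
  fin : ℕ → ℕ∞
  ∞   : ℕ∞

-- multiplication (the case 0·∞ never matters here; we set it to 0)
_⊗_ : ℕ∞ → ℕ∞ → ℕ∞
fin a ⊗ fin b = fin (a * b)
fin zero ⊗ ∞ = fin zero
fin (suc _) ⊗ ∞ = ∞
∞ ⊗ fin zero = fin zero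
∞ ⊗ fin (suc _) = ∞
∞ ⊗ ∞ = ∞

_≤∞_ : ℕ∞ → ℕ∞ → Set
fin a ≤∞ fin b = a ≤ b
fin _ ≤∞ ∞     = ⊤
∞     ≤∞ fin _ = ⊥
∞     ≤∞ ∞     = ⊤

IsMinOf : (ℕ → Set) → ℕ∞ → Set
IsMinOf P (fin c) = P c × (∀ c′ → P c′ → c ≤ c′)
IsMinOf P ∞       = ∀ c → ¬ P c

record Graph : Set₁ where
  field
    n     : ℕ
    Adj   : Fin n → Fin n → Set
    sym   : ∀ {u v} → Adj u v → Adj v u
    irrefl : ∀ {u} → ¬ Adj u u

module _ (G : Graph) where
  open Graph G

  Connected : Set
  Connected = ∀ (u v : Fin n) → ∃ λ (m : ℕ) → ∃ λ (p : ℕ → Fin n) →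
    p 0 ≡ u × p m ≡ v × (∀ i → i < m → Adj (p i) (p (suc i)))

  record Sub : Set₁ where
    field
      V     : Fin n → Set
      E     : Fin n → Fin n → Set
      E-sym : ∀ {u v} → E u v → E v u
      E⊆Adj : ∀ {u v} → E u v → Adj u v
      E⊆V   : ∀ {u v} → E u v → V u × V v

  record ClosedWalk : Set where
    field
      L        : ℕ
      L≥1      : 1 ≤ L
      w        : ℕ → Fin n
      periodic : ∀ i → w (i + L) ≡ w i
      steps    : ∀ i → Adj (w i) (w (suc i))

-- Finite multigraphs (loops and parallel edges allowed)

record Multigraph : Set where
  field
    nodes : ℕ
    edges : ℕ
    ends  : Fin edges → Fin nodes × Fin nodes

module _ (H : Multigraph) where
  open Multigraph H

  Joins : Fin edges → Fin nodes → Fin nodes → Set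
  Joins e a b = ends e ≡ (a , b) ⊎ ends e ≡ (b , a)

  Inc : Fin nodes → Fin edges → Set
  Inc h e = proj₁ (ends e) ≡ h ⊎ proj₂ (ends e) ≡ h

  CycleIn : (Fin edges → Set) → ℕ → Set
  CycleIn P k = 1 ≤ k × (∃ λ (c : ℕ → Fin nodes) → ∃ λ (ε : ℕ → Fin edges) →
      c k ≡ c 0
    × (∀ i → i < k → Joins (ε i) (c i) (c (suc i)) × P (ε i))
    × (∀ i j → i < k → j < k → c i ≡ c j → i ≡ j)
    × (∀ i j → i < k → j < k → ε i ≡ ε j → i ≡ j))

  CycleLength : ℕ → Set
  CycleLength = CycleIn (λ _ → ⊤)

record Decomp (G : Graph) : Set₁ where
  open Graph G
  field
    H  : Multigraph
  open Multigraph H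
  field
    part : Fin nodes → Sub G
  module P (h : Fin nodes) = Sub {G} (part h)
  field
    coverV : ∀ v → ∃ λ h → P.V h v
    coverE : ∀ u v → Adj u v → ∃ λ h → P.E h u v
    -- the subgraph of H induced on {h : v ∈ V(G_h)} is connected
    conn   : ∀ v h h′ → P.V h v → P.V h′ v →
      ∃ λ (m : ℕ) → ∃ λ (p : ℕ → Fin nodes) →
        p 0 ≡ h × p m ≡ h′ × (∀ i → i ≤ m → P.V (p i) v)
        × (∀ i → i < m → ∃ λ e → Joins H e (p i) (p (suc i)))

module _ {G : Graph} (D : Decomp G) where
  open Graph G
  open Decomp D
  open Multigraph H

  X : Fin edges → Fin n → Set
  X e v = P.V (proj₁ (ends e)) v × P.V (proj₂ (ends e)) v

  AdhesionDisjoint : Set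
  AdhesionDisjoint = ∀ e f → e ≢ f → ∀ v → ¬ (X e v × X f v)

  Bd : Fin nodes → Fin edges → Fin n → Fin n → Set
  Bd h e u v = P.E h u v × ((X e u × ¬ X e v) ⊎ (¬ X e u × X e v))

  -- the walk w i, w (i+1), …, w (i+1+s) (of length 1+s) is a traversal of s^e
  Traversal : (ℕ → Fin n) → Fin edges → ℕ → ℕ → Set
  Traversal w e i s =
      ((Bd h₀ e (w i) (w (suc i)) × Bd h₁ e (w (i + s)) (w (suc (i + s))))
       ⊎ (Bd h₁ e (w i) (w (suc i)) × Bd h₀ e (w (i + s)) (w (suc (i + s)))))
    × (∀ j → 1 ≤ j → j ≤ s → X e (w (i + j)))
    where
      h₀ = proj₁ (ends e)
      h₁ = proj₂ (ends e)

  module _ (W : ClosedWalk G) where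
    open ClosedWalk {G} W

    TravAt : Fin edges → ℕ → Set
    TravAt e i = ∃ λ s → suc s ≤ L × Traversal w e i s

    Traverses : Fin edges → Set
    Traverses e = ∃ λ i → i < L × TravAt e i

    AtMostOnce : Set
    AtMostOnce = ∀ e i j → i < L → j < L → TravAt e i → TravAt e j → i ≡ j

    HWHasCycle : Set
    HWHasCycle = ∃ λ k → CycleIn H Traverses k

  -- c = d_{G_h}(G_e, G_f) is realised for some node h and distinct edges
  -- e, f at h: there is a walk of length c in G_h from V(G_e) to V(G_f)
  AdhDist : ℕ → Set
  AdhDist c = ∃ λ h → ∃ λ e → ∃ λ f → e ≢ f × Inc H h e × Inc H h f ×
    (∃ λ (p : ℕ → Fin n) → X e (p 0) × X f (p c)
      × (∀ i → i ≤ c → P.V h (p i))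
      × (∀ i → i < c → P.E h (p i) (p (suc i))))

module Submission where

-- Let e₀, …, e₍ₖ₋₁₎ be the edges of a cycle in H^W; traversing s^e forces W through X^e.
-- Between a visit to X^e and a later visit to X^f with e ≠ f, W takes at least d(H,𝒢) steps:
-- a vertex outside all adhesion sets lies in a single part, so after its last visit to X^e
-- the walk runs inside one part G_h until it meets some X^f′ with f′ ≠ e, and disjointness
-- of the adhesion graphs makes both e and f′ incident with h. Hence the windows of length d
-- after the visits to X^e₀, …, X^e₍ₖ₋₁₎ are pairwise disjoint modulo the length L of W, so
-- k·d ≤ L, while g(H) ≤ k.

open import Defs
open import Data.Nat using (ℕ; zero; suc; _+_; _*_; _∸_; _≤_; _<_; _≤?_; z≤n; s≤s; NonZero; >-nonZero)
open import Data.Nat.Properties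
open import Data.Nat.DivMod using (_%_; _/_; m≡m%n+[m/n]*n; [m+kn]%n≡m%n; m<n⇒m%n≡m; m%n<n)
open import Algebra.Properties.CommutativeSemigroup +-commutativeSemigroup using (xy∙z≈xz∙y; x∙yz≈y∙xz)
open import Data.Fin using (Fin; zero; suc; toℕ; fromℕ<) renaming (_≟_ to _≟ᶠ_)
open import Data.Fin.Properties using (toℕ<n; toℕ-fromℕ<; toℕ-injective; injective⇒≤; *↔×)
open import Data.Product using (∃; _×_; _,_; proj₁; proj₂; map₂)
open import Data.Sum using (inj₁; inj₂; [_,_]′)
open import Data.Unit using (tt)
open import Data.Empty using (⊥-elim)
open import Function using (_∘_; Injection)
open import Function.Properties.Inverse using (Inverse⇒Injection)
open import Relation.Nullary using (¬_; Dec; yes; no; contradiction)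
open import Relation.Nullary.Decidable using (decidable-stable; ¬¬-excluded-middle)
open import Relation.Nullary.Negation using (¬¬-map)
open import Relation.Binary.PropositionalEquality

%-equal⇒common-multiple : ∀ u v L .{{_ : NonZero L}} → u % L ≡ v % L →
  u + (v / L) * L ≡ v + (u / L) * L
%-equal⇒common-multiple u v L eq = begin
  u + (v / L) * L                   ≡⟨ cong (_+ (v / L) * L) (m≡m%n+[m/n]*n u L) ⟩
  u % L + (u / L) * L + (v / L) * L ≡⟨ cong (λ x → x + (u / L) * L + (v / L) * L) eq ⟩
  v % L + (u / L) * L + (v / L) * L ≡⟨ xy∙z≈xz∙y (v % L) _ _ ⟩
  v % L + (v / L) * L + (u / L) * L ≡⟨ cong (_+ (u / L) * L) (m≡m%n+[m/n]*n v L) ⟨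
  v + (u / L) * L                   ∎
  where open ≡-Reasoning

remainder-unique : ∀ {r r′} L .{{_ : NonZero L}} M N → r < L → r′ < L →
  r + M * L ≡ r′ + N * L → r ≡ r′
remainder-unique {r} {r′} L M N r<L r′<L eq = begin
  r                 ≡⟨ m<n⇒m%n≡m r<L ⟨
  r % L             ≡⟨ [m+kn]%n≡m%n r M L ⟨
  (r + M * L) % L   ≡⟨ cong (_% L) eq ⟩
  (r′ + N * L) % L  ≡⟨ [m+kn]%n≡m%n r′ N L ⟩
  r′ % L            ≡⟨ m<n⇒m%n≡m r′<L ⟩
  r′                ∎
  where open ≡-Reasoning

module _ {k : ℕ} (L : ℕ) .{{_ : NonZero L}} (Q : Fin k → ℕ → Set)
         (periodic : ∀ {j i} → Q j i → Q j (i + L))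
         (visited : ∀ j → ∃ (Q j))
         (dd : ℕ) (separated : ∀ {j j′} → j ≢ j′ → ∀ {a} m → Q j a → Q j′ (m + a) → dd ≤ m)
         where

  periodic-multiple : ∀ {j i} N → Q j i → Q j (i + N * L)
  periodic-multiple {j} {i} zero q = subst (Q j) (sym (+-identityʳ i)) q
  periodic-multiple {j} {i} (suc N) q =
    subst (Q j) (trans (+-assoc i (N * L) L) (cong (i +_) (+-comm (N * L) L)))
                (periodic (periodic-multiple N q))

  separation<period : ∀ {j₀ j₁} → j₀ ≢ j₁ → dd < L
  separation<period {j₀} {j₁} j₀≢j₁ =
    ≤-<-trans (separated j₀≢j₁ (Δ % L) a∈Q (subst (Q j₁) (sym reach) y′∈Q)) (m%n<n Δ L)
    where
      x = proj₁ (visited j₀)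
      y′ = proj₁ (visited j₁) + x * L
      y′∈Q : Q j₁ y′
      y′∈Q = periodic-multiple x (proj₂ (visited j₁))
      Δ = y′ ∸ x
      a = x + (Δ / L) * L
      a∈Q : Q j₀ a
      a∈Q = periodic-multiple (Δ / L) (proj₂ (visited j₀))
      reach : Δ % L + a ≡ y′
      reach = begin
        Δ % L + (x + (Δ / L) * L) ≡⟨ x∙yz≈y∙xz (Δ % L) x _ ⟩
        x + (Δ % L + (Δ / L) * L) ≡⟨ cong (x +_) (m≡m%n+[m/n]*n Δ L) ⟨
        x + Δ                     ≡⟨ m+[n∸m]≡n (≤-trans (m≤m*n x L) (m≤n+m (x * L) _)) ⟩
        y′                        ∎
        where open ≡-Reasoning

  distinct-marks-far : ∀ {j j′ x y r r′} → j ≢ j′ → Q j x → Q j′ y → x + r ≡ y + r′ → r′ ≤ r →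
    dd ≤ r ∸ r′
  distinct-marks-far {x = x} {y} {r} {r′} j≢j′ x∈Q y∈Q eq r′≤r =
    separated j≢j′ (r ∸ r′) x∈Q (subst (Q _) (sym y≡) y∈Q)
    where
      open ≡-Reasoning
      y≡ : r ∸ r′ + x ≡ y
      y≡ = +-cancelʳ-≡ r′ _ _ (begin
        r ∸ r′ + x + r′ ≡⟨ xy∙z≈xz∙y (r ∸ r′) x r′ ⟩
        r ∸ r′ + r′ + x ≡⟨ cong (_+ x) (m∸n+n≡m r′≤r) ⟩
        r + x           ≡⟨ +-comm r x ⟩
        x + r           ≡⟨ eq ⟩
        y + r′          ∎)

  nearby-marks-equal : ∀ {j j′ x y r r′} → Q j x → Q j′ y → x + r ≡ y + r′ → r < dd → r′ < dd →
    j ≡ j′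
  nearby-marks-equal {j} {j′} {r = r} {r′} x∈Q y∈Q eq r<dd r′<dd with j ≟ᶠ j′ | ≤-total r′ r
  ... | yes j≡j′ | _ = j≡j′
  ... | no j≢j′ | inj₁ r′≤r = contradiction (distinct-marks-far j≢j′ x∈Q y∈Q eq r′≤r)
                                            (<⇒≱ (≤-<-trans (m∸n≤m r r′) r<dd))
  ... | no j≢j′ | inj₂ r≤r′ = contradiction (distinct-marks-far (j≢j′ ∘ sym) y∈Q x∈Q (sym eq) r≤r′)
                                            (<⇒≱ (≤-<-trans (m∸n≤m r′ r) r′<dd))

  position : Fin k → ℕ
  position j = proj₁ (visited j)

  -- The windows of length dd after the chosen visits are pairwise disjoint modulo L.
  window : Fin k × Fin dd → Fin L
  window (j , r) = fromℕ< (m%n<n (position j + toℕ r) L)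

  window-collision : ∀ {j j′ r r′} → window (j , r) ≡ window (j′ , r′) →
    ∃ λ M → ∃ λ N → position j + toℕ r + M * L ≡ position j′ + toℕ r′ + N * L
  window-collision {j} {j′} {r} {r′} eq =
    (position j′ + toℕ r′) / L , (position j + toℕ r) / L ,
    %-equal⇒common-multiple _ _ L (trans (sym (toℕ-fromℕ< _)) (trans (cong toℕ eq) (toℕ-fromℕ< _)))

  window-injective : dd < L → ∀ {a b} → window a ≡ window b → a ≡ b
  window-injective dd<L {j , r} {j′ , r′} eq with window-collision eq
  ... | M , N , common
    with refl ← nearby-marks-equal (periodic-multiple M (proj₂ (visited j)))
                  (periodic-multiple N (proj₂ (visited j′)))
                  (trans (xy∙z≈xz∙y (position j) (M * L) (toℕ r))
                         (trans common (xy∙z≈xz∙y (position j′) (toℕ r′) (N * L))))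
                  (toℕ<n r) (toℕ<n r′)
    = cong (j ,_) (toℕ-injective (remainder-unique L M N (<-trans (toℕ<n r) dd<L) (<-trans (toℕ<n r′) dd<L)
        (+-cancelˡ-≡ (position j) _ _ (trans (sym (+-assoc (position j) (toℕ r) (M * L)))
                                             (trans common (+-assoc (position j) (toℕ r′) (N * L)))))))

  marks-bound : ∀ {j₀ j₁} → j₀ ≢ j₁ → k * dd ≤ L
  marks-bound j₀≢j₁ =
    injective⇒≤ (Injection.injective (Inverse⇒Injection *↔×) ∘ window-injective (separation<period j₀≢j₁))

-- Membership in an adhesion set is undecidable, but the goals this is used for are decidable.
by-excluded-middle : ∀ {A Q : Set} → Dec Q → (Dec A → Q) → Q
by-excluded-middle Q? k = decidable-stable Q? (¬¬-map k ¬¬-excluded-middle)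

module _ {G : Graph} (D : Decomp G) (disjoint : AdhesionDisjoint D) where
  open Graph G hiding (sym)
  open Decomp D
  open Multigraph H

  joins⇒adhesion : ∀ {e a b v} → Joins H e a b → P.V a v → P.V b v → X D e v × Inc H a e
  joins⇒adhesion (inj₁ ends≡) av bv rewrite ends≡ = (av , bv) , inj₁ refl
  joins⇒adhesion (inj₂ ends≡) av bv rewrite ends≡ = (bv , av) , inj₂ refl

  shared-vertex⇒adhesion : ∀ {v h h′} → P.V h v → P.V h′ v → h ≢ h′ → ∃ λ e → X D e v × Inc H h e
  shared-vertex⇒adhesion {v} {h} {h′} hv h′v h≢h′ with conn v h h′ hv h′v
  ... | zero , p , refl , p₀≡h′ , _ , _ = contradiction p₀≡h′ h≢h′
  ... | suc m , p , refl , _ , on-path , path-edges with path-edges 0 (s≤s z≤n)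
  ...   | e , joins = e , joins⇒adhesion joins (on-path 0 z≤n) (on-path 1 (s≤s z≤n))

  adhesion-incident : ∀ {e v h} → X D e v → P.V h v → Inc H h e
  adhesion-incident {e} {v} {h} xe hv with proj₁ (ends e) ≟ᶠ h | proj₂ (ends e) ≟ᶠ h
  ... | yes h₀≡h | _ = inj₁ h₀≡h
  ... | no _ | yes h₁≡h = inj₂ h₁≡h
  ... | no h₀≢h | no h₁≢h with shared-vertex⇒adhesion hv (proj₁ xe) (h₀≢h ∘ sym)
  ...   | e′ , xe′ , h-e′ with e′ ≟ᶠ e
  ...     | yes refl = ⊥-elim ([ h₀≢h , h₁≢h ]′ h-e′)
  ...     | no e′≢e = ⊥-elim (disjoint e′ e e′≢e v (xe′ , xe))

  outside-adhesions⇒same-part : ∀ {v h h′} → ¬ (∃ λ e → X D e v) → P.V h v → P.V h′ v → h ≡ h′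
  outside-adhesions⇒same-part outside hv h′v with _ ≟ᶠ _
  ... | yes h≡h′ = h≡h′
  ... | no h≢h′ = contradiction (map₂ proj₁ (shared-vertex⇒adhesion hv h′v h≢h′)) outside

  module _ (w : ℕ → Fin n) (steps : ∀ i → Adj (w i) (w (suc i)))
           {dd : ℕ} (lower : ∀ c → AdhDist D c → dd ≤ c) where

    InPart : Fin nodes → ℕ → ℕ → Set
    InPart h a t = ∀ i → i < t → P.E h (w (i + a)) (w (suc (i + a)))

    InPart-snoc : ∀ {h a t} → InPart h a t → P.E h (w (t + a)) (w (suc (t + a))) → InPart h a (suc t)
    InPart-snoc {t = t} part edge i i<1+t with m≤n⇒m<n∨m≡n (≤-pred i<1+t)
    ... | inj₁ i<t = part i i<t
    ... | inj₂ refl = edge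

    InPart-vertices : ∀ {h a t} → InPart h a (suc t) → ∀ i → i ≤ suc t → P.V h (w (i + a))
    InPart-vertices {t = t} part i i≤1+t with m≤n⇒m<n∨m≡n i≤1+t
    ... | inj₁ i<1+t = proj₁ (P.E⊆V _ (part i i<1+t))
    ... | inj₂ refl = proj₂ (P.E⊆V _ (part t ≤-refl))

    private module Between {e f : Fin edges} (e≢f : e ≢ f) {B : ℕ} (xf : X D f (w B)) where

      -- k counts the steps left until position B. A run of the walk inside one part G_h that
      -- starts in X^e ends in an adhesion set X^f′: for f′ = e we restart there, otherwise the
      -- run is a path in G_h between adhesion graphs of two distinct edges at h.
      mutual
        from-adhesion : ∀ k a → k + a ≡ B → X D e (w a) → dd ≤ k
        from-adhesion zero a a≡B xe =
          ⊥-elim (disjoint e f e≢f (w a) (xe , subst (X D f ∘ w) (sym a≡B) xf))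
        from-adhesion (suc k) a eq xe with coverE (w a) (w (suc a)) (steps a)
        ... | h , edge = arrive k a 0 h (trans (+-suc k a) eq) xe
                           (adhesion-incident xe (proj₁ (P.E⊆V h edge))) (InPart-snoc (λ _ ()) edge)

        arrive : ∀ k a t h → k + (suc t + a) ≡ B → X D e (w a) → Inc H h e → InPart h a (suc t) →
          dd ≤ suc t + k
        arrive k a t h eq xe h-e part = by-excluded-middle (dd ≤? suc t + k) next
          where
            next : Dec (∃ λ f′ → X D f′ (w (suc t + a))) → dd ≤ suc t + k
            next (yes (f′ , xf′)) with e ≟ᶠ f′
            ... | yes refl = ≤-trans (from-adhesion k (suc t + a) eq xf′) (m≤n+m k (suc t))
            ... | no e≢f′ = ≤-trans (lower (suc t) (h , e , f′ , e≢f′ , h-e ,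
                                        adhesion-incident xf′ (InPart-vertices part (suc t) ≤-refl) ,
                                        (λ i → w (i + a)) , xe , xf′ , InPart-vertices part , part))
                                     (m≤m+n (suc t) k)
            next (no outside) = extend k a t h eq xe h-e part outside

        extend : ∀ k a t h → k + (suc t + a) ≡ B → X D e (w a) → Inc H h e → InPart h a (suc t) →
          ¬ (∃ λ f′ → X D f′ (w (suc t + a))) → dd ≤ suc t + k
        extend zero a t h eq _ _ _ outside = contradiction (f , subst (X D f ∘ w) (sym eq) xf) outside
        extend (suc k) a t h eq xe h-e part outside
          with coverE (w (suc t + a)) (w (suc (suc t + a))) (steps _)
        ... | h′ , edge′ = subst (dd ≤_) (sym (+-suc (suc t) k))
                             (arrive k a (suc t) h (trans (+-suc k (suc t + a)) eq) xe h-e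
                                     (InPart-snoc part edge))
          where
            edge : P.E h (w (suc t + a)) (w (suc (suc t + a)))
            edge = subst (λ h″ → P.E h″ _ _)
                     (outside-adhesions⇒same-part outside (proj₁ (P.E⊆V h′ edge′))
                                                          (InPart-vertices part (suc t) ≤-refl))
                     edge′

    walk-between-adhesions : ∀ {e f a} m → e ≢ f → X D e (w a) → X D f (w (m + a)) → dd ≤ m
    walk-between-adhesions m e≢f xe xf = Between.from-adhesion e≢f xf m _ refl xe

module _ (H : Multigraph) where
  open Multigraph H

  CycleIn⇒CycleLength : ∀ P {k} → CycleIn H P k → CycleLength H k
  CycleIn⇒CycleLength _ (k≥1 , c , ε , closed , edges , c-inj , ε-inj) =
    k≥1 , c , ε , closed , (λ i i<k → proj₁ (edges i i<k) , tt) , c-inj , ε-inj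

  joins-self⇒loop : ∀ {e a} → Joins H e a a → proj₁ (ends e) ≡ proj₂ (ends e)
  joins-self⇒loop (inj₁ ends≡) = trans (cong proj₁ ends≡) (sym (cong proj₂ ends≡))
  joins-self⇒loop (inj₂ ends≡) = trans (cong proj₁ ends≡) (sym (cong proj₂ ends≡))

module _ {G : Graph} (D : Decomp G) where
  open Decomp D
  open Multigraph H

  not-boundary-of-both-parts : ∀ {e u v} →
    Bd D (proj₁ (ends e)) e u v → ¬ Bd D (proj₂ (ends e)) e u v
  not-boundary-of-both-parts (E₀ , inj₁ (_ , v∉X)) (E₁ , _) =
    v∉X (proj₂ (P.E⊆V _ E₀) , proj₂ (P.E⊆V _ E₁))
  not-boundary-of-both-parts (E₀ , inj₂ (u∉X , _)) (E₁ , _) =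
    u∉X (proj₁ (P.E⊆V _ E₀) , proj₁ (P.E⊆V _ E₁))

  module _ (W : ClosedWalk G) where
    open ClosedWalk W

    traversed-not-loop : ∀ {e} → proj₁ (ends e) ≡ proj₂ (ends e) → ¬ Traverses D W e
    traversed-not-loop loop (_ , _ , _ , _ , inj₁ (bd₀ , _) , _) =
      not-boundary-of-both-parts bd₀ (subst (λ h → Bd D h _ _ _) loop bd₀)
    traversed-not-loop loop (_ , _ , _ , _ , inj₂ (bd₁ , _) , _) =
      not-boundary-of-both-parts (subst (λ h → Bd D h _ _ _) (sym loop) bd₁) bd₁

    traversal-meets-adhesion : ∀ {e} → Traverses D W e → ∃ λ i → X D e (w i)
    traversal-meets-adhesion (i , _ , zero , _ , inj₁ (bd₀ , bd₁) , _) =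
      ⊥-elim (not-boundary-of-both-parts bd₀ (subst (λ j → Bd D _ _ (w j) (w (suc j))) (+-identityʳ i) bd₁))
    traversal-meets-adhesion (i , _ , zero , _ , inj₂ (bd₁ , bd₀) , _) =
      ⊥-elim (not-boundary-of-both-parts (subst (λ j → Bd D _ _ (w j) (w (suc j))) (+-identityʳ i) bd₀) bd₁)
    traversal-meets-adhesion (i , _ , suc _ , _ , _ , inside) = i + 1 , inside 1 (s≤s z≤n) (s≤s z≤n)

    traversed-cycle-bound : AdhesionDisjoint D → ∀ {k dd} → CycleIn H (Traverses D W) k →
      (∀ c → AdhDist D c → dd ≤ c) → k * dd ≤ L
    traversed-cycle-bound _ {zero} (() , _)
    traversed-cycle-bound _ {suc zero} (_ , c , ε , closed , edges , _) _ =
      ⊥-elim (traversed-not-loop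
                (joins-self⇒loop H (subst (Joins H (ε 0) (c 0)) closed (proj₁ (edges 0 ≤-refl))))
                (proj₂ (edges 0 ≤-refl)))
    traversed-cycle-bound disjoint {suc (suc k)} {dd} (_ , c , ε , _ , edges , _ , ε-inj) lower =
      marks-bound L {{>-nonZero L≥1}} Q (λ {j} {i} → subst (X D (ε (toℕ j))) (sym (periodic i)))
                  visited dd separated {zero} {suc zero} (λ ())
      where
        Q : Fin (suc (suc k)) → ℕ → Set
        Q j i = X D (ε (toℕ j)) (w i)
        visited : ∀ j → ∃ (Q j)
        visited j = traversal-meets-adhesion (proj₂ (edges (toℕ j) (toℕ<n j)))
        separated : ∀ {j j′} → j ≢ j′ → ∀ {a} m → Q j a → Q j′ (m + a) → dd ≤ m
        separated j≢j′ m = walk-between-adhesions D disjoint w steps lower m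
                             (j≢j′ ∘ toℕ-injective ∘ ε-inj _ _ (toℕ<n _) (toℕ<n _))

corollary5p12 : (G : Graph) → Connected G → (D : Decomp G) →
    AdhesionDisjoint D →
    (g d : ℕ∞) → IsMinOf (CycleLength (Decomp.H D)) g → IsMinOf (AdhDist D) d →
    (W : ClosedWalk G) → AtMostOnce D W → HWHasCycle D W →
    (g ⊗ d) ≤∞ fin (ClosedWalk.L W)
corollary5p12 G _ D _ ∞ _ no-cycle _ W _ (k , cycle) =
  ⊥-elim (no-cycle k (CycleIn⇒CycleLength (Decomp.H D) (Traverses D W) cycle))
corollary5p12 G _ D _ (fin zero) ∞ _ _ W _ _ = z≤n
corollary5p12 G _ D disjoint (fin (suc _)) ∞ _ no-adhesion-path W _ (k , cycle) =
  <⇒≱ (<-≤-trans (n<1+n L) (m≤n*m (suc L) k {{>-nonZero (proj₁ cycle)}}))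
      (traversed-cycle-bound D W disjoint cycle (λ c path → ⊥-elim (no-adhesion-path c path)))
  where open ClosedWalk W
corollary5p12 G _ D disjoint (fin g) (fin dd) (_ , g-least) (_ , dd-least) W _ (k , cycle) =
  ≤-trans (*-monoˡ-≤ dd (g-least k (CycleIn⇒CycleLength (Decomp.H D) (Traverses D W) cycle)))
          (traversed-cycle-bound D W disjoint cycle dd-least)
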